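{- Let $G$ be a graph, $r\ge1$ an integer, $c\colon V(G)\to[\xi]$ a $(2r+2)$-centred colouring of $G$ with $\xi=\chi_{2r+2}(G)$, and $\emptyset\ne X\subseteq V(G)$. Let $\mathcal S_{\le r}$ be the set of all signatures over $[\xi]$ of length at most $r$. Define the relation $u\simeq^{\Sigma}_r v$ on $V(G)$ to hold iff $N^\sigma(u)\cap X=N^\sigma(v)\cap X$ for every $\sigma\in\mathcal S_{\le r}$. Then $\simeq^{\Sigma}_r$ is a refinement of the relation $\simeq^X_{r-1}$, i.e. $u\simeq^\Sigma_r v$ implies $N^{r-1}[u]\cap X=N^{r-1}[v]\cap X$.
   Context: Graphs are finite, simple, non-empty. An $s$-centred colouring is a vertex colouring such that every connected subgraph either has a colour appearing on exactly one of its vertices or receives at least $s$ colours; $\chi_s(G)$ is the minimum number of colours of such a colouring. A signature over $[\xi]$ is a finite sequence $\sigma=(\sigma[1],\dots,\sigma[\ell])$ of elements of $[\xi]$, of length $|\sigma|=\ell$. A path $x_1\dots x_\ell$ (distinct vertices, consecutive ones adjacent) is a $\sigma$-path if $\ell=|\sigma|$ and $c(x_i)=\sigma[i]$. $N^\sigma(v)$ is the set of $w$ such that some $\sigma$-path starts at $v$ and ends at $w$. $N^{k}[v]$ is the set of vertices at distance at most $k$ from $v$ in $G$, and $u\simeq^X_k v$ iff $N^k[u]\cap X=N^k[v]\cap X$. -}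

module Defs where

open import Data.Nat using (ℕ; zero; suc; _≤_)
open import Data.Fin using (Fin)
open import Data.Fin.Subset using (Subset; _∈_; Nonempty)
open import Data.Bool using (Bool; true; false; T)
open import Data.List using (List; []; _∷_; map; length; _∷ʳ_)
open import Data.List.Relation.Unary.Unique.Propositional using (Unique)
open import Data.List.Relation.Unary.Linked using (Linked)
open import Data.Sum using (_⊎_)
open import Data.Product using (Σ; ∃; ∃-syntax; _×_; _,_)
open import Function.Definitions using (Injective)
open import Function.Bundles using (_⇔_)
open import Relation.Binary.PropositionalEquality using (_≡_)

record Graph : Set where
  field
    n        : ℕ
    nonEmpty : 1 ≤ n
    adj      : Fin n → Fin n → Bool
    adj-sym  : ∀ u v → adj u v ≡ adj v u
    adj-irr  : ∀ v → adj v v ≡ false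

module _ (G : Graph) where
  open Graph G

  V : Set
  V = Fin n

  E : V → V → Set
  E u v = T (adj u v)

  data WalkIn (S : Subset n) : V → V → Set where
    here : ∀ {u} → u ∈ S → WalkIn S u u
    step : ∀ {u x w} → u ∈ S → E u x → WalkIn S x w → WalkIn S u w

  Connected : Subset n → Set
  Connected S = Nonempty S × (∀ u v → u ∈ S → v ∈ S → WalkIn S u v)

  UniqueColour : ∀ {ξ} → (V → Fin ξ) → Subset n → Set
  UniqueColour c S = ∃[ v ] (v ∈ S × (∀ w → w ∈ S → c w ≡ c v → w ≡ v))

  AtLeastColours : ∀ {ξ} → ℕ → (V → Fin ξ) → Subset n → Set
  AtLeastColours s c S =
    Σ (Fin s → V) λ f → (∀ i → f i ∈ S) × Injective _≡_ _≡_ (λ i → c (f i))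

  IsCentred : ∀ {ξ} → ℕ → (V → Fin ξ) → Set
  IsCentred s c = ∀ S → Connected S → UniqueColour c S ⊎ AtLeastColours s c S

  IsChi : ℕ → ℕ → Set
  IsChi s ξ = (∃[ c ] IsCentred {ξ} s c)
            × (∀ k (c : V → Fin k) → IsCentred s c → ξ ≤ k)

  IsPath : List V → Set
  IsPath xs = Unique xs × Linked E xs

  -- w ∈ N^σ(v): some σ-path starts at v and ends at w (signatures are lists)
  Nsig : ∀ {ξ} → (V → Fin ξ) → List (Fin ξ) → V → V → Set
  Nsig c σ v w = ∃[ ys ] (IsPath (v ∷ ys) × map c (v ∷ ys) ≡ σ
                          × ∃[ zs ] (zs ∷ʳ w ≡ v ∷ ys))

  data WalkLe : ℕ → V → V → Set where
    here : ∀ {k u} → WalkLe k u u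
    step : ∀ {k u x w} → E u x → WalkLe k x w → WalkLe (suc k) u w

  Ball : ℕ → V → V → Set
  Ball k v w = WalkLe k v w

  SimX : Subset n → ℕ → V → V → Set
  SimX X k u v = ∀ w → w ∈ X → (Ball k u w ⇔ Ball k v w)

  SimΣ : ∀ {ξ} → (V → Fin ξ) → Subset n → ℕ → V → V → Set
  SimΣ c X r u v = ∀ (σ : List (Fin _)) → length σ ≤ r →
                   ∀ w → w ∈ X → (Nsig c σ u w ⇔ Nsig c σ v w)

-- A walk of length at most k from u to w can be shortened to a path with at most
-- k edges; its colour sequence is a signature σ of length at most k + 1 with
-- w ∈ N^σ(u).  If N^σ(u) and N^σ(v) agree on X, then w ∈ X gives a σ-path from v
-- to w, i.e. a walk with |σ| − 1 ≤ k edges.  Take k = r − 1.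
module Submission where

open import Defs
open import Data.Nat using (ℕ; _≤_; _+_; _*_; _∸_; suc; s≤s; s≤s⁻¹; z≤n)
open import Data.Nat.Properties using (≤-refl; ≤-trans; ≤-reflexive; m≤n⇒m≤1+n; n≤1+n)
open import Data.Fin using (Fin; _≟_)
open import Data.Fin.Subset using (Subset; Nonempty)
open import Data.List using (List; []; _∷_; [_]; map; length; _∷ʳ_)
open import Data.List.Properties using (length-map; ∷-injectiveʳ)
open import Data.List.Relation.Unary.All using (All; []; _∷_)
open import Data.List.Relation.Unary.AllPairs using ([]; _∷_)
open import Data.List.Relation.Unary.Linked using (Linked; [-]; _∷_)
open import Data.Sum using (_⊎_; inj₁; inj₂)
open import Data.Product using (∃-syntax; _×_; _,_)
open import Function.Bundles using (mk⇔; Equivalence)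
open import Relation.Binary.PropositionalEquality using (_≡_; _≢_; refl; sym; cong)
open import Relation.Nullary using (yes; no)

EndsAt : {A : Set} → List A → A → Set
EndsAt xs w = ∃[ zs ] (zs ∷ʳ w ≡ xs)

EndsAt-[-] : {A : Set} {x w : A} → EndsAt [ x ] w → x ≡ w
EndsAt-[-] ([] , refl) = refl
EndsAt-[-] (_ ∷ [] , ())
EndsAt-[-] (_ ∷ _ ∷ _ , ())

EndsAt-tail : {A : Set} {x y w : A} {ys : List A} →
              EndsAt (x ∷ y ∷ ys) w → EndsAt (y ∷ ys) w
EndsAt-tail ([] , ())
EndsAt-tail (_ ∷ zs , eq) = zs , ∷-injectiveʳ eq

EndsAt-∷ : {A : Set} (x : A) {xs : List A} {w : A} → EndsAt xs w → EndsAt (x ∷ xs) w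
EndsAt-∷ x (zs , eq) = x ∷ zs , cong (x ∷_) eq

module _ (G : Graph) where

  WalkLe-mono : ∀ {k k′ u w} → k ≤ k′ → WalkLe G k u w → WalkLe G k′ u w
  WalkLe-mono _          here          = here
  WalkLe-mono (s≤s k≤k′) (step e rest) = step e (WalkLe-mono k≤k′ rest)

  Linked⇒WalkLe : ∀ {u ys w} → Linked (E G) (u ∷ ys) → EndsAt (u ∷ ys) w →
                  WalkLe G (length ys) u w
  Linked⇒WalkLe {ys = []}    _           ends with EndsAt-[-] ends
  ... | refl = here
  Linked⇒WalkLe {ys = _ ∷ _} (e ∷ links) ends = step e (Linked⇒WalkLe links (EndsAt-tail ends))

  record PathLe (k : ℕ) (u w : V G) : Set where
    field
      rest    : List (V G)
      isPath  : IsPath G (u ∷ rest)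
      endsAt  : EndsAt (u ∷ rest) w
      length≤ : length rest ≤ k

  PathLe-mono : ∀ {k k′ u w} → k ≤ k′ → PathLe k u w → PathLe k′ u w
  PathLe-mono k≤k′ record { rest = ys ; isPath = path ; endsAt = ends ; length≤ = len } =
    record { rest = ys ; isPath = path ; endsAt = ends ; length≤ = ≤-trans len k≤k′ }

  fresh-or-suffix : ∀ u {x ys w} → IsPath G (x ∷ ys) → EndsAt (x ∷ ys) w →
                    All (u ≢_) (x ∷ ys) ⊎ PathLe (length ys) u w
  fresh-or-suffix u {x} {ys} path ends with u ≟ x
  ... | yes refl = inj₂ (record { rest = ys ; isPath = path ; endsAt = ends ; length≤ = ≤-refl })
  fresh-or-suffix u {ys = []} _ _ | no u≢x = inj₁ (u≢x ∷ [])
  fresh-or-suffix u {ys = _ ∷ _} (_ ∷ distinct , _ ∷ links) ends | no u≢x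
    with fresh-or-suffix u (distinct , links) (EndsAt-tail ends)
  ... | inj₁ fresh = inj₁ (u≢x ∷ fresh)
  ... | inj₂ p     = inj₂ (PathLe-mono (n≤1+n _) p)

  WalkLe⇒PathLe : ∀ {k u w} → WalkLe G k u w → PathLe k u w
  WalkLe⇒PathLe here = record { rest = [] ; isPath = [] ∷ [] , [-] ; endsAt = [] , refl ; length≤ = z≤n }
  WalkLe⇒PathLe {u = u} (step e walk) with WalkLe⇒PathLe walk
  ... | record { rest = ys ; isPath = distinct , links ; endsAt = ends ; length≤ = len }
    with fresh-or-suffix u (distinct , links) ends
  ... | inj₁ fresh = record { rest = _ ∷ ys ; isPath = fresh ∷ distinct , e ∷ links
                            ; endsAt = EndsAt-∷ u ends ; length≤ = s≤s len }
  ... | inj₂ p     = PathLe-mono (m≤n⇒m≤1+n len) p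

  module _ {ξ : ℕ} (c : V G → Fin ξ) where

    Ball⇒Nsig : ∀ {k u w} → Ball G k u w → ∃[ σ ] (length σ ≤ suc k × Nsig G c σ u w)
    Ball⇒Nsig walk with WalkLe⇒PathLe walk
    ... | record { rest = ys ; isPath = path ; endsAt = ends ; length≤ = len } =
      map c (_ ∷ ys) , s≤s (≤-trans (≤-reflexive (length-map c ys)) len) , ys , path , refl , ends

    Nsig⇒Ball : ∀ {k σ u w} → length σ ≤ suc k → Nsig G c σ u w → Ball G k u w
    Nsig⇒Ball {u = u} |σ|≤ (ys , (_ , links) , refl , ends) =
      WalkLe-mono (s≤s⁻¹ (≤-trans (≤-reflexive (sym (length-map c (u ∷ ys)))) |σ|≤))
                  (Linked⇒WalkLe links ends)

    Ball-transfer : ∀ {k u v w} →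
                    (∀ σ → length σ ≤ suc k → Nsig G c σ u w → Nsig G c σ v w) →
                    Ball G k u w → Ball G k v w
    Ball-transfer transfer ball with Ball⇒Nsig ball
    ... | σ , |σ|≤ , u→w = Nsig⇒Ball |σ|≤ (transfer σ |σ|≤ u→w)

lemma4 : (G : Graph) (r : ℕ) → 1 ≤ r → (ξ : ℕ) (c : V G → Fin ξ) →
         IsCentred G (2 + 2 * r) c → IsChi G (2 + 2 * r) ξ →
         (X : Subset (Graph.n G)) → Nonempty X →
         ∀ u v → SimΣ G c X r u v → SimX G X (r ∸ 1) u v
lemma4 G (suc r) _ ξ c _ _ X _ u v sim w w∈X =
  mk⇔ (Ball-transfer G c λ σ |σ|≤ → Equivalence.to   (sim σ |σ|≤ w w∈X))
      (Ball-transfer G c λ σ |σ|≤ → Equivalence.from (sim σ |σ|≤ w w∈X))
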